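{- Let $F=\langle W,R,\{S_x\}_{x\in W}\rangle$ be any $\mathbf{ILS}$-frame. Then $\mathbf{J2}_+$ is valid in $F$ if and only if $\mathbf{J4}$ is valid in $F$ and the following holds: for all $x,y\in W$, all $V_0,V_1\subseteq W$ and every family $(U_z)_{z\in V_0\cap R[x]}$ of subsets of $W$, if $yS_x(V_0\cup V_1)$ and $zS_xU_z$ for every $z\in V_0\cap R[x]$, then $yS_x\left(\bigcup_{z\in V_0\cap R[x]}U_z\cup V_1\right)$. Here $R[x]=\{y\in W: xRy\}$.
   Context: Formulas are built from propositional variables, $\top,\bot$, $\neg,\land,\lor,\to$, unary $\Box$ and binary $\rhd$; $\Diamond A$ abbreviates $\neg\Box\neg A$. Schemata: $\mathbf{J2}_+$: $(A\rhd(B\lor C))\land(B\rhd C)\to A\rhd C$; $\mathbf{J4}$: $A\rhd B\to(\Diamond A\to\Diamond B)$. An $\mathbf{ILS}$-frame is a triple $\langle W,R,\{S_x\}_{x\in W}\rangle$ with $W$ nonempty, $R$ transitive and conversely well-founded on $W$, each $S_x\subseteq W\times(\mathcal P(W)\setminus\{\emptyset\})$ such that $yS_xV$ implies $xRy$, and (monotonicity) $yS_xV$ and $V\subseteq U$ imply $yS_xU$. Satisfaction: usual Boolean clauses, $x\Vdash\Box A$ iff $y\Vdash A$ for all $y$ with $xRy$, and $x\Vdash A\rhd B$ iff for every $y$ with $xRy$ and $y\Vdash A$ there is $V\subseteq W$ with $yS_xV$ and $z\Vdash B$ for all $z\in V$. A schema is valid in a frame if every instance holds at every point under every satisfaction relation.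 -}

module Defs where

open import Data.Nat using (ℕ)
open import Data.Product using (Σ; _×_; _,_)
open import Data.Sum using (_⊎_)
open import Data.Unit.Polymorphic using (⊤)
open import Data.Empty.Polymorphic using (⊥)
open import Relation.Nullary using (¬_)
open import Function using (flip)
open import Induction.WellFounded using (WellFounded)
open import Level using (Level; Lift; suc; zero)

Subset : Set → Set₁
Subset W = W → Set

_⊆_ : {W : Set} → Subset W → Subset W → Set
V ⊆ U = ∀ w → V w → U w

_∪_ : {W : Set} → Subset W → Subset W → Subset W
(V ∪ U) w = V w ⊎ U w

NonEmpty : {W : Set} → Subset W → Set
NonEmpty {W} V = Σ W V

infixr 4 _⇒_
infixr 5 _∨'_
infixr 6 _∧'_
infix 7 _▷_
data Fm : Set where
  var  : ℕ → Fm
  ⊤'   : Fm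
  ⊥'   : Fm
  ¬'_  : Fm → Fm
  _∧'_ : Fm → Fm → Fm
  _∨'_ : Fm → Fm → Fm
  _⇒_  : Fm → Fm → Fm
  □_   : Fm → Fm
  _▷_  : Fm → Fm → Fm

◇_ : Fm → Fm
◇ A = ¬' (□ (¬' A))

record ILSFrame : Set₁ where
  field
    W     : Set
    inh   : W
    R     : W → W → Set
    R-trans : ∀ {x y z} → R x y → R y z → R x z
    R-cwf   : WellFounded (flip R)
    S     : W → W → Subset W → Set              -- S x y V  means  y S_x V
    S-nonempty : ∀ {x y V} → S x y V → NonEmpty V
    S-R   : ∀ {x y V} → S x y V → R x y
    S-mono : ∀ {x y V U} → S x y V → V ⊆ U → S x y U

module _ (F : ILSFrame) where
  open ILSFrame F

  Valuation : Set₁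
  Valuation = ℕ → W → Set

  -- forcing relation (in Set₁, since ▷ quantifies over subsets of W)
  Forces : Valuation → W → Fm → Set₁
  Forces v x (var p)  = Lift (suc zero) (v p x)
  Forces v x ⊤'       = ⊤
  Forces v x ⊥'       = ⊥
  Forces v x (¬' A)   = ¬ Forces v x A
  Forces v x (A ∧' B) = Forces v x A × Forces v x B
  Forces v x (A ∨' B) = Forces v x A ⊎ Forces v x B
  Forces v x (A ⇒ B)  = Forces v x A → Forces v x B
  Forces v x (□ A)    = ∀ y → R x y → Forces v y A
  Forces v x (A ▷ B)  = ∀ y → R x y → Forces v y A →
                          Σ (Subset W) λ V → S x y V × (∀ z → V z → Forces v z B)

  Valid3 : (Fm → Fm → Fm → Fm) → Set₁
  Valid3 φ = ∀ (A B C : Fm) (v : Valuation) (x : W) → Forces v x (φ A B C)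

  Valid2 : (Fm → Fm → Fm) → Set₁
  Valid2 φ = ∀ (A B : Fm) (v : Valuation) (x : W) → Forces v x (φ A B)

  -- R[x] membership is R x z; the frame condition of Proposition 3.17
  J2+Condition : Set₁
  J2+Condition =
    ∀ (x y : W) (V₀ V₁ : Subset W)
      (U : (z : W) → V₀ z → R x z → Subset W) →
      S x y (V₀ ∪ V₁) →
      (∀ z (p : V₀ z) (q : R x z) → S x z (U z p q)) →
      S x y ((λ w → Σ W λ z → Σ (V₀ z) λ p → Σ (R x z) λ q → U z p q w) ∪ V₁)

J2+ : Fm → Fm → Fm → Fm
J2+ A B C = ((A ▷ (B ∨' C)) ∧' (B ▷ C)) ⇒ (A ▷ C)

J4 : Fm → Fm → Fm
J4 A B = (A ▷ B) ⇒ ((◇ A) ⇒ (◇ B))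

-- The three implications are proved separately.
--  * J2₊ ⇒ J4: instantiate C := ⊥.  From A ▷ B and □¬B one gets A ▷ (B ∨ ⊥)
--    and B ▷ ⊥, hence A ▷ ⊥; but A ▷ ⊥ forces □¬A, because S_x only relates
--    points to nonempty sets.
--  * J2₊ ⇒ condition: use the canonical valuation p₀ = {y}, p₁ = V₀,
--    p₂ = ⋃ U_z ∪ V₁; then x ⊩ p₀ ▷ (p₁ ∨ p₂) and x ⊩ p₁ ▷ p₂, so J2₊ yields
--    a set V ⊆ p₂ with y S_x V, and monotonicity finishes.
--  * condition ⇒ J2₊: given a witness V for A ▷ (B ∨ C) at y, split V into
--    the points where the B-disjunct holds (V₀) and those where C holds (V₁),
--    choose witnesses U_z for B ▷ C at z ∈ V₀, and apply the condition.
--    (This direction does not need J4.)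
-- Forcing lives in Set₁ while subsets of W are Set-valued, so splitting V
-- along a disjunction uses Boolean tags on the sum rather than the sum itself.
module Submission where

open import Defs
open import Data.Bool using (T)
open import Data.Empty using (⊥-elim)
open import Data.Maybe using (is-just; to-witness-T)
open import Data.Nat using (zero; suc)
open import Data.Product using (Σ; _×_; _,_; proj₁; proj₂)
open import Data.Sum using (_⊎_; inj₁; inj₂; isInj₁; isInj₂; [_,_]′; map)
open import Data.Unit using (tt)
open import Function.Bundles using (_⇔_; mk⇔)
open import Level using (lift; lower)
open import Relation.Binary.PropositionalEquality using (_≡_; refl)

IsInj₁ IsInj₂ : {A B : Set₁} → A ⊎ B → Set
IsInj₁ s = T (is-just (isInj₁ s))
IsInj₂ s = T (is-just (isInj₂ s))

fromIsInj₁ : {A B : Set₁} (s : A ⊎ B) → IsInj₁ s → A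
fromIsInj₁ s = to-witness-T (isInj₁ s)

fromIsInj₂ : {A B : Set₁} (s : A ⊎ B) → IsInj₂ s → B
fromIsInj₂ s = to-witness-T (isInj₂ s)

isInj₁-or-isInj₂ : {A B : Set₁} (s : A ⊎ B) → IsInj₁ s ⊎ IsInj₂ s
isInj₁-or-isInj₂ (inj₁ _) = inj₁ tt
isInj₁-or-isInj₂ (inj₂ _) = inj₂ tt

module _ (F : ILSFrame) where
  open ILSFrame F

  Glued : (x : W) (V₀ V₁ : Subset W) → ((z : W) → V₀ z → R x z → Subset W) → Subset W
  Glued x V₀ V₁ U = (λ w → Σ W λ z → Σ (V₀ z) λ p → Σ (R x z) λ q → U z p q w) ∪ V₁

  -- A ▷ ⊥ at x refutes A at every successor: a witness set would have to be
  -- nonempty and consist of points forcing ⊥.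
  ▷⊥⇒□¬ : ∀ v x A → Forces F v x (A ▷ ⊥') → Forces F v x (□ (¬' A))
  ▷⊥⇒□¬ v x A A▷⊥ y xRy y⊩A with A▷⊥ y xRy y⊩A
  ... | V , ySV , V⊩⊥ with S-nonempty ySV
  ...   | z , z∈V = lower (V⊩⊥ z z∈V)

  J2+⇒J4 : Valid3 F J2+ → Valid2 F J4
  J2+⇒J4 j2+ A B v x A▷B ◇A □¬B = ◇A (▷⊥⇒□¬ v x A A▷⊥)
    where
      A▷B∨⊥ : Forces F v x (A ▷ (B ∨' ⊥'))
      A▷B∨⊥ y xRy y⊩A with A▷B y xRy y⊩A
      ... | V , ySV , V⊩B = V , ySV , λ z z∈V → inj₁ (V⊩B z z∈V)

      B▷⊥ : Forces F v x (B ▷ ⊥')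
      B▷⊥ y xRy y⊩B = ⊥-elim (□¬B y xRy y⊩B)

      A▷⊥ : Forces F v x (A ▷ ⊥')
      A▷⊥ = j2+ A B ⊥' v x (A▷B∨⊥ , B▷⊥)

  J2+⇒condition : Valid3 F J2+ → J2+Condition F
  J2+⇒condition j2+ x y V₀ V₁ U yS[V₀∪V₁] zSU =
    let V , ySV , V⊩p₂ = p₀▷p₂ y (S-R yS[V₀∪V₁]) (lift refl)
    in S-mono ySV λ w w∈V → lower (V⊩p₂ w w∈V)
    where
      v : Valuation F
      v zero          w = w ≡ y
      v (suc zero)    w = V₀ w
      v (suc (suc _)) w = Glued x V₀ V₁ U w

      p₀▷p₁∨p₂ : Forces F v x (var 0 ▷ (var 1 ∨' var 2))
      p₀▷p₁∨p₂ .y _ (lift refl) =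
        V₀ ∪ V₁ , yS[V₀∪V₁] , λ where
          z (inj₁ z∈V₀) → inj₁ (lift z∈V₀)
          z (inj₂ z∈V₁) → inj₂ (lift (inj₂ z∈V₁))

      p₁▷p₂ : Forces F v x (var 1 ▷ var 2)
      p₁▷p₂ z xRz (lift z∈V₀) =
        U z z∈V₀ xRz , zSU z z∈V₀ xRz , λ w w∈U → lift (inj₁ (z , z∈V₀ , xRz , w∈U))

      p₀▷p₂ : Forces F v x (var 0 ▷ var 2)
      p₀▷p₂ = j2+ (var 0) (var 1) (var 2) v x (p₀▷p₁∨p₂ , p₁▷p₂)

  condition⇒J2+ : J2+Condition F → Valid3 F J2+
  condition⇒J2+ cond A B C v x (A▷B∨C , B▷C) y xRy y⊩A with A▷B∨C y xRy y⊩A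
  ... | V , ySV , V⊩B∨C = _ , cond x y V₀ V₁ Uᶻ (S-mono ySV V⊆V₀∪V₁) zSUᶻ , Glued⊩C
    where
      V₀ V₁ : Subset W
      V₀ z = Σ (V z) λ z∈V → IsInj₁ (V⊩B∨C z z∈V)
      V₁ z = Σ (V z) λ z∈V → IsInj₂ (V⊩B∨C z z∈V)

      V⊆V₀∪V₁ : V ⊆ (V₀ ∪ V₁)
      V⊆V₀∪V₁ z z∈V = map (z∈V ,_) (z∈V ,_) (isInj₁-or-isInj₂ (V⊩B∨C z z∈V))

      z⊩B : ∀ z → V₀ z → Forces F v z B
      z⊩B z (z∈V , tag) = fromIsInj₁ (V⊩B∨C z z∈V) tag

      B▷C-at : ∀ z → V₀ z → R x z → Σ (Subset W) λ U → S x z U × (∀ w → U w → Forces F v w C)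
      B▷C-at z z∈V₀ xRz = B▷C z xRz (z⊩B z z∈V₀)

      Uᶻ : (z : W) → V₀ z → R x z → Subset W
      Uᶻ z z∈V₀ xRz = proj₁ (B▷C-at z z∈V₀ xRz)

      zSUᶻ : ∀ z (z∈V₀ : V₀ z) (xRz : R x z) → S x z (Uᶻ z z∈V₀ xRz)
      zSUᶻ z z∈V₀ xRz = proj₁ (proj₂ (B▷C-at z z∈V₀ xRz))

      Uᶻ⊩C : ∀ z (z∈V₀ : V₀ z) (xRz : R x z) w → Uᶻ z z∈V₀ xRz w → Forces F v w C
      Uᶻ⊩C z z∈V₀ xRz = proj₂ (proj₂ (B▷C-at z z∈V₀ xRz))

      Glued⊩C : ∀ w → Glued x V₀ V₁ Uᶻ w → Forces F v w C
      Glued⊩C w = [ (λ { (z , z∈V₀ , xRz , w∈U) → Uᶻ⊩C z z∈V₀ xRz w w∈U })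
                  , (λ { (w∈V , tag) → fromIsInj₂ (V⊩B∨C w w∈V) tag }) ]′

proposition3p17 : (F : ILSFrame) →
    Valid3 F J2+ ⇔ (Valid2 F J4 × J2+Condition F)
proposition3p17 F = mk⇔ (λ j2+ → J2+⇒J4 F j2+ , J2+⇒condition F j2+)
                        (λ (_ , cond) → condition⇒J2+ F cond)
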